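{- Let $n \ge 1$ be an integer and let $G$ be a directed graph on a vertex set $V$ with $|V| = n$, initially with no edges. For each vertex $v \in V$ let $p_v \in [0,1]$. Generate edges randomly as follows: independently for each vertex $v$, choose a vertex $w$ uniformly at random from $V$ (possibly $w = v$), and with probability $p_v$ (independently of everything else) call $v$ good and add a directed edge from $v$ to $w$; otherwise add no edge from $v$. Then the probability that the resulting graph contains a directed cycle (a self-loop counting as a directed cycle) is exactly $\frac{1}{n}\sum_{v \in V} p_v$.
   Formalization: The probabilities $p_v$ are rational numbers in [0,1] instead of real numbers in [0,1]. -}

module Defs where

open import Data.Nat using (ℕ; zero; suc; NonZero)
open import Data.Fin using (Fin; zero; suc; inject₁; fromℕ)
open import Data.Bool using (Bool; true; false; if_then_else_)
open import Data.List using (List; []; _∷_; map; concatMap; foldr; allFin)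
open import Data.Product using (Σ; _×_; _,_)
open import Data.Integer using (+_)
open import Data.Rational using (ℚ; 0ℚ; 1ℚ; _+_; _*_; _-_; _/_)
open import Relation.Binary.PropositionalEquality using (_≡_)
open import Function.Definitions using (Injective)

sumL : {A : Set} → List A → (A → ℚ) → ℚ
sumL xs f = foldr (λ x acc → f x + acc) 0ℚ xs

prodFin : (n : ℕ) → (Fin n → ℚ) → ℚ
prodFin n f = foldr (λ x acc → f x * acc) 1ℚ (allFin n)

sumFin : (n : ℕ) → (Fin n → ℚ) → ℚ
sumFin n f = sumL (allFin n) f

consF : {k : ℕ} {B : Set} → B → (Fin k → B) → Fin (suc k) → B
consF b f zero = b
consF b f (suc i) = f i

allFuns : {B : Set} → (k : ℕ) → List B → List (Fin k → B)
allFuns zero xs = (λ ()) ∷ []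
allFuns (suc k) xs = concatMap (λ b → map (consF b) (allFuns k xs)) xs

-- An outcome of the random experiment on vertex set Fin n:
-- for each vertex v, the uniformly chosen vertex w = target v,
-- and whether v is good.
record Outcome (n : ℕ) : Set where
  constructor outcome
  field
    target : Fin n → Fin n
    good   : Fin n → Bool
open Outcome public

allOutcomes : (n : ℕ) → List (Outcome n)
allOutcomes n = concatMap (λ t → map (outcome t) (allFuns n (true ∷ false ∷ []))) (allFuns n (allFin n))

weight : (n : ℕ) → .{{_ : NonZero n}} → (Fin n → ℚ) → Outcome n → ℚ
weight n p o = prodFin n (λ v → (+ 1 / n) * (if good o v then p v else 1ℚ - p v))

Edge : {n : ℕ} → Outcome n → Fin n → Fin n → Set
Edge o v w = (good o v ≡ true) × (target o v ≡ w)

HasDirectedCycle : {n : ℕ} → Outcome n → Set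
HasDirectedCycle {n} o =
  Σ ℕ λ k → Σ (Fin (suc k) → Fin n) λ c →
    Injective _≡_ _≡_ c
    × ((i : Fin k) → Edge o (c (inject₁ i)) (c (suc i)))
    × Edge o (c (fromℕ k)) (c zero)

{-# OPTIONS --safe #-}
-- Let vertex v point to w with probability p v * q w and nowhere otherwise (here q w = 1/n).
-- Then a directed cycle appears with probability Σ_v p v * q v, by induction on the number of
-- vertices, conditioning on the out-edge of vertex 0.  Without out-edge, 0 lies on no cycle and is
-- deleted; a loop is a cycle; an edge 0 → w can be contracted, which preserves the existence of a
-- cycle and leaves a law of the same shape with q w replaced by q w + q 0, whose cycle probability
-- is Σ_{v≠0} p v * q v + p w * q 0.  Averaging the three cases gives p 0 * q 0 + Σ_{v≠0} p v * q v.
--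
-- The cycle indicator is computed by the same recursion (hasCycle).  It detects the simple cycles
-- of the statement because, when every vertex has at most one out-edge, a closed walk through v
-- cut at its minimal period is a simple cycle.
module Submission where

open import Defs
open import Data.Nat using (ℕ; NonZero)
open import Data.Fin using (Fin)
open import Data.Product using (_×_)
open import Data.Integer using (+_)
open import Data.Rational using (ℚ; 0ℚ; 1ℚ; _*_; _/_; _≤_)
open import Relation.Binary.PropositionalEquality using (_≡_)
open import Relation.Nullary using (¬_)

open import Algebra.Bundles using (CommutativeMonoid; CommutativeRing)
open import Data.Bool using (Bool; true; false; if_then_else_)
open import Data.Empty using (⊥-elim; ⊥-elim-irr)
open import Data.Fin using (zero; suc; toℕ; fromℕ; fromℕ<; inject₁)
open import Data.Fin.Properties
  using ( _≟_; toℕ-injective; toℕ<n; toℕ≤pred[n]; toℕ-fromℕ; toℕ-fromℕ<; toℕ-inject; toℕ-inject₁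
        ; ¬∀⟶∃¬-smallest)
open import Data.Integer.Properties using (+◃n≡+n)
open import Data.List using (List; []; _∷_; _++_; map; concatMap; foldr; allFin; tabulate; cartesianProduct)
open import Data.Maybe as Maybe using (Maybe; just; nothing; _>>=_)
open import Data.Maybe.Properties using (just-injective)
open import Data.Nat as ℕ using (zero; suc; _<_; _∸_; s≤s)
open import Data.Nat.Coprimality using (1-coprimeTo)
open import Data.Nat.GeneralisedArithmetic using (iterate)
open import Data.Nat.Properties as ℕ
  using (<-cmp; ≮⇒≥; ≤-refl; ≤-trans; <⇒≤; +-suc; +-monoˡ-<; m+[n∸m]≡n)
open import Data.Product using (Σ; ∃; _,_; proj₁; proj₂)
open import Data.Rational using (_+_; _-_; 1/_)
open import Data.Rational.Literals using (fromℤ)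
open import Data.Rational.Properties
  using ( +-identityˡ; +-identityʳ; +-assoc; +-comm; *-assoc; *-comm; *-zeroˡ; *-zeroʳ
        ; *-identityˡ; *-identityʳ
        ; *-distribˡ-+; *-distribʳ-+; *-inverseʳ; normalize-coprime; toℚᵘ-injective; toℚᵘ-homo-+
        ; +-0-commutativeMonoid; +-*-commutativeRing; *-1-monoid)
import Data.Rational.Unnormalised as ℚᵘ
import Data.Rational.Unnormalised.Properties as ℚᵘ
open import Data.Rational.Solver using (module +-*-Solver)
open import Data.Sum using (_⊎_; inj₁; inj₂)
open import Data.Vec.Functional as Vector using (updateAt)
open import Function using (_∘_; id)
open import Function.Definitions using (Injective)
open import Relation.Binary.Core using (_Preserves_⟶_)
open import Relation.Binary.Definitions using (tri<; tri≈; tri>)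
open import Relation.Binary.PropositionalEquality
  using (_≢_; _≗_; refl; sym; trans; cong; cong₂; subst; module ≡-Reasoning)
open import Relation.Nullary using (¬?; contradiction)
open import Relation.Nullary.Decidable using (decidable-stable)
open import Relation.Unary using (Decidable)

open import Algebra.Properties.CommutativeSemigroup
  (CommutativeMonoid.commutativeSemigroup +-0-commutativeMonoid) using (interchange)
open import Algebra.Properties.Semiring.Sum (CommutativeRing.semiring +-*-commutativeRing)
  using (sum; sum-cong-≗; ∑-distrib-+; *-distribˡ-sum; *-distribʳ-sum)
open import Algebra.Properties.Monoid.Sum *-1-monoid
  using () renaming (sum to ∏; sum-cong-≗ to ∏-cong-≗)
open +-*-Solver using (solve; _:=_; _:+_; _:*_; _:-_; con)
open ≡-Reasoning

private variable
  A B C : Set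
  k n : ℕ

sumL-cong : (xs : List A) {f g : A → ℚ} → f ≗ g → sumL xs f ≡ sumL xs g
sumL-cong []       f≗g = refl
sumL-cong (x ∷ xs) f≗g = cong₂ _+_ (f≗g x) (sumL-cong xs f≗g)

sumL-++ : (xs ys : List A) (f : A → ℚ) → sumL (xs ++ ys) f ≡ sumL xs f + sumL ys f
sumL-++ []       ys f = sym (+-identityˡ _)
sumL-++ (x ∷ xs) ys f = trans (cong (_+_ (f x)) (sumL-++ xs ys f)) (sym (+-assoc (f x) _ _))

sumL-map : (g : A → B) (xs : List A) (f : B → ℚ) → sumL (map g xs) f ≡ sumL xs (f ∘ g)
sumL-map g []       f = refl
sumL-map g (x ∷ xs) f = cong (_+_ (f (g x))) (sumL-map g xs f)

sumL-concatMap : (g : A → List B) (xs : List A) (f : B → ℚ) →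
  sumL (concatMap g xs) f ≡ sumL xs (λ x → sumL (g x) f)
sumL-concatMap g []       f = refl
sumL-concatMap g (x ∷ xs) f =
  trans (sumL-++ (g x) _ f) (cong (_+_ (sumL (g x) f)) (sumL-concatMap g xs f))

sumL-cartesianProduct : (xs : List A) (ys : List B) (f : A × B → ℚ) →
  sumL (cartesianProduct xs ys) f ≡ sumL xs (λ x → sumL ys (λ y → f (x , y)))
sumL-cartesianProduct []       ys f = refl
sumL-cartesianProduct (x ∷ xs) ys f = begin
  sumL (map (x ,_) ys ++ cartesianProduct xs ys) f
    ≡⟨ sumL-++ (map (x ,_) ys) _ f ⟩
  sumL (map (x ,_) ys) f + sumL (cartesianProduct xs ys) f
    ≡⟨ cong₂ _+_ (sumL-map (x ,_) ys f) (sumL-cartesianProduct xs ys f) ⟩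
  sumL ys (λ y → f (x , y)) + sumL xs (λ x′ → sumL ys (λ y → f (x′ , y))) ∎

*-distribˡ-sumL : (c : ℚ) (xs : List A) (f : A → ℚ) → c * sumL xs f ≡ sumL xs (λ x → c * f x)
*-distribˡ-sumL c []       f = *-zeroʳ c
*-distribˡ-sumL c (x ∷ xs) f =
  trans (*-distribˡ-+ c (f x) _) (cong (_+_ (c * f x)) (*-distribˡ-sumL c xs f))

sumL-distrib-+ : (xs : List A) (f g : A → ℚ) → sumL xs (λ x → f x + g x) ≡ sumL xs f + sumL xs g
sumL-distrib-+ []       f g = refl
sumL-distrib-+ (x ∷ xs) f g =
  trans (cong (_+_ (f x + g x)) (sumL-distrib-+ xs f g)) (interchange (f x) (g x) _ _)

sumL-zero : (xs : List A) → sumL xs (λ _ → 0ℚ) ≡ 0ℚ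
sumL-zero []       = refl
sumL-zero (x ∷ xs) = trans (+-identityˡ _) (sumL-zero xs)

sumL-comm : (xs : List A) (ys : List B) (f : A → B → ℚ) →
  sumL xs (λ x → sumL ys (f x)) ≡ sumL ys (λ y → sumL xs (λ x → f x y))
sumL-comm []       ys f = sym (sumL-zero ys)
sumL-comm (x ∷ xs) ys f =
  trans (cong (_+_ (sumL ys (f x))) (sumL-comm xs ys f)) (sym (sumL-distrib-+ ys (f x) _))

foldr-tabulate : (_∙_ : A → B → B) (e : B) (g : Fin k → C) (f : C → A) →
  foldr (λ x acc → f x ∙ acc) e (tabulate g) ≡ Vector.foldr _∙_ e (f ∘ g)
foldr-tabulate {k = zero}  _∙_ e g f = refl
foldr-tabulate {k = suc k} _∙_ e g f = cong (f (g zero) ∙_) (foldr-tabulate _∙_ e (g ∘ suc) f)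

sumFin≡sum : (f : Fin k → ℚ) → sumFin k f ≡ sum f
sumFin≡sum = foldr-tabulate _+_ 0ℚ id

prodFin≡∏ : (f : Fin k → ℚ) → prodFin k f ≡ ∏ f
prodFin≡∏ = foldr-tabulate _*_ 1ℚ id

fromℤ-suc : (m : ℕ) → fromℤ (+ suc m) ≡ 1ℚ + fromℤ (+ m)
fromℤ-suc m = toℚᵘ-injective (ℚᵘ.≃-trans 1+m≃ (ℚᵘ.≃-sym (toℚᵘ-homo-+ 1ℚ (fromℤ (+ m)))))
  where
  1+m≃ : ℚᵘ.mkℚᵘ (+ suc m) 0 ℚᵘ.≃ ℚᵘ.mkℚᵘ (+ 1) 0 ℚᵘ.+ ℚᵘ.mkℚᵘ (+ m) 0
  1+m≃ rewrite ℕ.*-identityʳ m | +◃n≡+n m = ℚᵘ.*≡* refl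

sum-const : (m : ℕ) (c : ℚ) → sum (λ (_ : Fin m) → c) ≡ fromℤ (+ m) * c
sum-const zero    c = sym (*-zeroˡ c)
sum-const (suc m) c = begin
  c + sum (λ (_ : Fin m) → c)   ≡⟨ cong₂ _+_ (sym (*-identityˡ c)) (sum-const m c) ⟩
  1ℚ * c + fromℤ (+ m) * c      ≡⟨ *-distribʳ-+ c 1ℚ (fromℤ (+ m)) ⟨
  (1ℚ + fromℤ (+ m)) * c        ≡⟨ cong (_* c) (fromℤ-suc m) ⟨
  fromℤ (+ suc m) * c           ∎

sum-uniform : (n : ℕ) .{{_ : NonZero n}} → sum (λ (_ : Fin n) → + 1 / n) ≡ 1ℚ
sum-uniform zero {{n≢0}} = ⊥-elim-irr (ℕ.≢-nonZero⁻¹ 0 {{n≢0}} refl)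
sum-uniform (suc m) = begin
  sum (λ (_ : Fin (suc m)) → + 1 / suc m)
    ≡⟨ sum-const (suc m) (+ 1 / suc m) ⟩
  fromℤ (+ suc m) * (+ 1 / suc m)
    ≡⟨ cong (fromℤ (+ suc m) *_) (normalize-coprime (1-coprimeTo (suc m))) ⟩
  fromℤ (+ suc m) * 1/ fromℤ (+ suc m)
    ≡⟨ *-inverseʳ (fromℤ (+ suc m)) ⟩
  1ℚ ∎

sum-updateAt-+ : (F : Fin k → ℚ → ℚ) → (∀ u a b → F u (a + b) ≡ F u a + F u b) →
  (q : Fin k → ℚ) (w : Fin k) (c : ℚ) →
  sum (λ u → F u (updateAt q w (_+ c) u)) ≡ sum (λ u → F u (q u)) + F w c
sum-updateAt-+ F additive q zero c = begin
  F zero (q zero + c) + S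
    ≡⟨ cong (_+ S) (additive zero (q zero) c) ⟩
  (F zero (q zero) + F zero c) + S
    ≡⟨ solve 3 (λ a b s → (a :+ b) :+ s := (a :+ s) :+ b) refl (F zero (q zero)) (F zero c) S ⟩
  (F zero (q zero) + S) + F zero c ∎
  where S = sum (λ u → F (suc u) (q (suc u)))
sum-updateAt-+ F additive q (suc w) c =
  trans (cong (_+_ (F zero (q zero))) (sum-updateAt-+ (F ∘ suc) (additive ∘ suc) (q ∘ suc) w c))
        (sym (+-assoc (F zero (q zero)) _ _))

-- Expectations under product weights

𝔼 : (k : ℕ) → List B → (Fin k → B → ℚ) → ((Fin k → B) → ℚ) → ℚ
𝔼 k xs μ F = sumL (allFuns k xs) (λ f → ∏ (λ v → μ v (f v)) * F f)

consF-cong : (b : B) {f g : Fin k → B} → f ≗ g → consF b f ≗ consF b g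
consF-cong b f≗g zero    = refl
consF-cong b f≗g (suc i) = f≗g i

sumL-allFuns-suc : (xs : List B) (G : (Fin (suc k) → B) → ℚ) →
  sumL (allFuns (suc k) xs) G ≡ sumL xs (λ b → sumL (allFuns k xs) (G ∘ consF b))
sumL-allFuns-suc {k = k} xs G =
  trans (sumL-concatMap (λ b → map (consF b) (allFuns k xs)) xs G)
        (sumL-cong xs (λ b → sumL-map (consF b) (allFuns k xs) G))

sumL-allFuns-cartesianProduct : (xs : List A) (ys : List B) (K : (Fin k → A × B) → ℚ) →
  K Preserves _≗_ ⟶ _≡_ →
  sumL (allFuns k xs) (λ f → sumL (allFuns k ys) (λ g → K (λ v → f v , g v)))
    ≡ sumL (allFuns k (cartesianProduct xs ys)) K
sumL-allFuns-cartesianProduct {k = zero}  xs ys K K-cong =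
  cong (_+ 0ℚ) (trans (+-identityʳ _) (K-cong (λ ())))
sumL-allFuns-cartesianProduct {k = suc k} xs ys K K-cong = begin
  sumL (allFuns (suc k) xs) (λ f → sumL (allFuns (suc k) ys) (λ g → K (λ v → f v , g v)))
    ≡⟨ sumL-allFuns-suc xs (λ f → sumL (allFuns (suc k) ys) (λ g → K (λ v → f v , g v))) ⟩
  sumL xs (λ x → sumL (allFuns k xs) (λ f → sumL (allFuns (suc k) ys) (λ g → K (λ v → consF x f v , g v))))
    ≡⟨ sumL-cong xs (λ x → sumL-cong (allFuns k xs) (λ f →
         sumL-allFuns-suc ys (λ g → K (λ v → consF x f v , g v)))) ⟩
  sumL xs (λ x → sumL (allFuns k xs) (λ f → sumL ys (λ y → sumL (allFuns k ys) (λ g →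
    K (λ v → consF x f v , consF y g v)))))
    ≡⟨ sumL-cong xs (λ x → sumL-comm (allFuns k xs) ys (λ f y → sumL (allFuns k ys) (λ g →
         K (λ v → consF x f v , consF y g v)))) ⟩
  sumL xs (λ x → sumL ys (λ y → sumL (allFuns k xs) (λ f → sumL (allFuns k ys) (λ g →
    K (λ v → consF x f v , consF y g v)))))
    ≡⟨ sumL-cong xs (λ x → sumL-cong ys (λ y → sumL-cong (allFuns k xs) (λ f →
         sumL-cong (allFuns k ys) (λ g → K-cong λ { zero → refl ; (suc v) → refl })))) ⟩
  sumL xs (λ x → sumL ys (λ y → sumL (allFuns k xs) (λ f → sumL (allFuns k ys) (λ g →
    K (consF (x , y) (λ v → f v , g v))))))
    ≡⟨ sumL-cong xs (λ x → sumL-cong ys (λ y →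
         sumL-allFuns-cartesianProduct xs ys (K ∘ consF (x , y)) (K-cong ∘ consF-cong (x , y)))) ⟩
  sumL xs (λ x → sumL ys (λ y → sumL (allFuns k (cartesianProduct xs ys)) (K ∘ consF (x , y))))
    ≡⟨ sumL-cartesianProduct xs ys (λ z → sumL (allFuns k (cartesianProduct xs ys)) (K ∘ consF z)) ⟨
  sumL (cartesianProduct xs ys) (λ z → sumL (allFuns k (cartesianProduct xs ys)) (K ∘ consF z))
    ≡⟨ sumL-allFuns-suc (cartesianProduct xs ys) K ⟨
  sumL (allFuns (suc k) (cartesianProduct xs ys)) K ∎

𝔼-cong : (xs : List B) (μ : Fin k → B → ℚ) {F G : (Fin k → B) → ℚ} → F ≗ G →
  𝔼 k xs μ F ≡ 𝔼 k xs μ G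
𝔼-cong {k = k} xs μ F≗G =
  sumL-cong (allFuns k xs) (λ f → cong (∏ (λ v → μ v (f v)) *_) (F≗G f))

𝔼-suc : (xs : List B) (μ : Fin (suc k) → B → ℚ) (F : (Fin (suc k) → B) → ℚ) →
  𝔼 (suc k) xs μ F ≡ sumL xs (λ b → μ zero b * 𝔼 k xs (μ ∘ suc) (F ∘ consF b))
𝔼-suc {B = B} {k = k} xs μ F =
  trans (sumL-allFuns-suc xs (λ f → ∏ (λ v → μ v (f v)) * F f)) (sumL-cong xs λ b →
    trans (sumL-cong (allFuns k xs) (λ f → *-assoc (μ zero b) (∏′ f) (F (consF b f))))
          (sym (*-distribˡ-sumL (μ zero b) (allFuns k xs) (λ f → ∏′ f * F (consF b f)))))
  where
  ∏′ : (Fin k → B) → ℚ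
  ∏′ f = ∏ (λ v → μ (suc v) (f v))

𝔼-one : (xs : List B) (μ : Fin k → B → ℚ) → (∀ v → sumL xs (μ v) ≡ 1ℚ) →
  𝔼 k xs μ (λ _ → 1ℚ) ≡ 1ℚ
𝔼-one {k = zero}  xs μ total = refl
𝔼-one {k = suc k} xs μ total = begin
  𝔼 (suc k) xs μ (λ _ → 1ℚ)
    ≡⟨ 𝔼-suc xs μ (λ _ → 1ℚ) ⟩
  sumL xs (λ b → μ zero b * 𝔼 k xs (μ ∘ suc) (λ _ → 1ℚ))
    ≡⟨ sumL-cong xs (λ b →
         trans (cong (μ zero b *_) (𝔼-one xs (μ ∘ suc) (total ∘ suc))) (*-identityʳ (μ zero b))) ⟩
  sumL xs (μ zero)
    ≡⟨ total zero ⟩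
  1ℚ ∎

IsPushforward : List B → (B → ℚ) → (B → C) → List C → (C → ℚ) → Set
IsPushforward {C = C} xs μ φ ys ν =
  ∀ (G : C → ℚ) → sumL xs (λ x → μ x * G (φ x)) ≡ sumL ys (λ y → ν y * G y)

𝔼-pushforward : (xs : List B) (ys : List C) (φ : B → C)
  (μ : Fin k → B → ℚ) (ν : Fin k → C → ℚ) →
  (∀ v → IsPushforward xs (μ v) φ ys (ν v)) →
  (F : (Fin k → C) → ℚ) → F Preserves _≗_ ⟶ _≡_ →
  𝔼 k xs μ (λ f → F (φ ∘ f)) ≡ 𝔼 k ys ν F
𝔼-pushforward {k = zero}  xs ys φ μ ν push F F-cong = cong (λ z → 1ℚ * z + 0ℚ) (F-cong (λ ()))
𝔼-pushforward {C = C} {k = suc k} xs ys φ μ ν push F F-cong = begin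
  𝔼 (suc k) xs μ (λ f → F (φ ∘ f))
    ≡⟨ 𝔼-suc xs μ (λ f → F (φ ∘ f)) ⟩
  sumL xs (λ x → μ zero x * 𝔼 k xs (μ ∘ suc) (λ f → F (φ ∘ consF x f)))
    ≡⟨ sumL-cong xs (λ x → cong (μ zero x *_) (trans
         (𝔼-cong xs (μ ∘ suc) {λ f → F (φ ∘ consF x f)} {λ f → F (consF (φ x) (φ ∘ f))}
           (λ f → F-cong λ { zero → refl ; (suc v) → refl }))
         (𝔼-pushforward xs ys φ (μ ∘ suc) (ν ∘ suc) (push ∘ suc)
           (F ∘ consF (φ x)) (F-cong ∘ consF-cong (φ x))))) ⟩
  sumL xs (λ x → μ zero x * 𝔼′ (φ x))
    ≡⟨ push zero 𝔼′ ⟩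
  sumL ys (λ y → ν zero y * 𝔼′ y)
    ≡⟨ 𝔼-suc ys ν F ⟨
  𝔼 (suc k) ys ν F ∎
  where
  𝔼′ : C → ℚ
  𝔼′ y = 𝔼 k ys (ν ∘ suc) (F ∘ consF y)

-- Graphs of out-degree at most one

FunGraph : ℕ → Set
FunGraph k = Fin k → Maybe (Fin k)

outEdges : (k : ℕ) → List (Maybe (Fin k))
outEdges k = nothing ∷ map just (allFin k)

sumL-outEdges : (G : Maybe (Fin k) → ℚ) → sumL (outEdges k) G ≡ G nothing + sum (G ∘ just)
sumL-outEdges {k = k} G =
  cong (_+_ (G nothing)) (trans (sumL-map just (allFin k) G) (sumFin≡sum (G ∘ just)))

dropZero : Maybe (Fin (suc k)) → Maybe (Fin k)
dropZero nothing        = nothing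
dropZero (just zero)    = nothing
dropZero (just (suc u)) = just u

mergeZeroInto : Fin k → Fin (suc k) → Fin k
mergeZeroInto w zero    = w
mergeZeroInto w (suc u) = u

hasCycle : FunGraph k → Bool
hasCycleVia : Maybe (Fin (suc k)) → (Fin k → Maybe (Fin (suc k))) → Bool
hasCycle {k = zero}  f = false
hasCycle {k = suc k} f = hasCycleVia (f zero) (f ∘ suc)
hasCycleVia nothing        g = hasCycle (dropZero ∘ g)
hasCycleVia (just zero)    g = true
hasCycleVia (just (suc w)) g = hasCycle (Maybe.map (mergeZeroInto w) ∘ g)

hasCycle-cong : {f g : FunGraph k} → f ≗ g → hasCycle f ≡ hasCycle g
hasCycleVia-cong : (b : Maybe (Fin (suc k))) {f g : Fin k → Maybe (Fin (suc k))} → f ≗ g →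
  hasCycleVia b f ≡ hasCycleVia b g
hasCycle-cong {k = zero}          f≗g = refl
hasCycle-cong {k = suc k} {f} {g} f≗g =
  trans (cong (λ b → hasCycleVia b (f ∘ suc)) (f≗g zero)) (hasCycleVia-cong (g zero) (f≗g ∘ suc))
hasCycleVia-cong nothing        f≗g = hasCycle-cong (cong dropZero ∘ f≗g)
hasCycleVia-cong (just zero)    f≗g = refl
hasCycleVia-cong (just (suc w)) f≗g = hasCycle-cong (cong (Maybe.map (mergeZeroInto w)) ∘ f≗g)

walk : FunGraph k → ℕ → Fin k → Maybe (Fin k)
walk f zero    x = just x
walk f (suc m) x = f x >>= walk f m

Cyclic : FunGraph k → Set
Cyclic {k = k} f = Σ (Fin k) λ v → Σ ℕ λ m → walk f (suc m) v ≡ just v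

>>=-just⁻¹ : (mx : Maybe A) (g : A → Maybe B) {y : B} → (mx >>= g) ≡ just y →
  ∃ λ x → mx ≡ just x × g x ≡ just y
>>=-just⁻¹ (just x) g eq = x , refl , eq

walk-suc⁻¹ : (f : FunGraph k) (m : ℕ) {x y : Fin k} → walk f (suc m) x ≡ just y →
  ∃ λ a → f x ≡ just a × walk f m a ≡ just y
walk-suc⁻¹ f m {x} = >>=-just⁻¹ (f x) (walk f m)

walk-step : (f : FunGraph k) (m : ℕ) {x y : Fin k} → f x ≡ just y → walk f (suc m) x ≡ walk f m y
walk-step f m eq = cong (_>>= walk f m) eq

module Deletion {k} (f : FunGraph (suc k)) (no-edge : f zero ≡ nothing) where

  g : FunGraph k
  g = dropZero ∘ f ∘ suc

  no-walk-from-zero : ∀ m {y} → walk f (suc m) zero ≢ just y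
  no-walk-from-zero m e with walk-suc⁻¹ f m e
  ... | _ , e₁ , _ with () ← trans (sym no-edge) e₁

  zero-isolated : ∀ m {u} → walk f m zero ≢ just (suc u)
  zero-isolated zero    ()
  zero-isolated (suc m) = no-walk-from-zero m

  walk⇒ : ∀ m {v u} → walk f m (suc v) ≡ just (suc u) → walk g m v ≡ just u
  walk⇒ zero    refl = refl
  walk⇒ (suc m) e with walk-suc⁻¹ f m e
  ... | zero  , _  , e₂ = ⊥-elim (zero-isolated m e₂)
  ... | suc a , e₁ , e₂ = trans (walk-step g m (cong dropZero e₁)) (walk⇒ m e₂)

  dropZero⁻¹ : (b : Maybe (Fin (suc k))) {a : Fin k} → dropZero b ≡ just a → b ≡ just (suc a)
  dropZero⁻¹ (just (suc u)) refl = refl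

  walk⇐ : ∀ m {v u} → walk g m v ≡ just u → walk f m (suc v) ≡ just (suc u)
  walk⇐ zero    refl = refl
  walk⇐ (suc m) {v} e with walk-suc⁻¹ g m e
  ... | a , e₁ , e₂ = trans (walk-step f m (dropZero⁻¹ (f (suc v)) e₁)) (walk⇐ m e₂)

  cyclic⇒ : Cyclic f → Cyclic g
  cyclic⇒ (zero  , m , e) = ⊥-elim (no-walk-from-zero m e)
  cyclic⇒ (suc v , m , e) = v , m , walk⇒ (suc m) e

  cyclic⇐ : Cyclic g → Cyclic f
  cyclic⇐ (v , m , e) = suc v , m , walk⇐ (suc m) e

module Contraction {k} (f : FunGraph (suc k)) (w : Fin k) (edge : f zero ≡ just (suc w)) where

  π : Fin (suc k) → Fin k
  π = mergeZeroInto w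

  g : FunGraph k
  g = Maybe.map π ∘ f ∘ suc

  walk⇒ : ∀ m {x y} → walk f m x ≡ just y → ∃ λ m′ → walk g m′ (π x) ≡ just (π y)
  walk⁺⇒ : ∀ m {u y} → walk f (suc m) (suc u) ≡ just y →
    ∃ λ m′ → walk g (suc m′) u ≡ just (π y)
  walk⇒ zero    refl = 0 , refl
  walk⇒ (suc m) {zero} e with walk-suc⁻¹ f m e
  ... | a , e₁ , e₂ with trans (sym edge) e₁
  ... | refl = walk⇒ m e₂
  walk⇒ (suc m) {suc u} e with walk⁺⇒ m e
  ... | m′ , e′ = suc m′ , e′
  walk⁺⇒ m {u} e with walk-suc⁻¹ f m e
  ... | a , e₁ , e₂ with walk⇒ m e₂
  ... | m′ , e′ = m′ , trans (walk-step g m′ (cong (Maybe.map π) e₁)) e′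

  cyclic⇒ : Cyclic f → Cyclic g
  cyclic⇒ (suc u , m , e) with walk⁺⇒ m e
  ... | m′ , e′ = u , m′ , e′
  cyclic⇒ (zero , m , e) with trans (sym (walk-step f m edge)) e
  cyclic⇒ (zero , zero ,  e) | ()
  cyclic⇒ (zero , suc m , e) | e′ with walk⁺⇒ m e′
  ... | m′ , e″ = w , m′ , e″

  map-π⁻¹ : (b : Maybe (Fin (suc k))) {a : Fin k} → Maybe.map π b ≡ just a →
    (b ≡ just zero × a ≡ w) ⊎ b ≡ just (suc a)
  map-π⁻¹ (just zero)    refl = inj₁ (refl , refl)
  map-π⁻¹ (just (suc u)) refl = inj₂ refl

  -- an edge u → a of g comes from an edge suc u → suc a of f, or from suc u → 0 → suc w with a = w
  prepend : ∀ m {u a y} → g u ≡ just a → walk f m (suc a) ≡ just y →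
    ∃ λ m′ → walk f (suc m′) (suc u) ≡ just y
  prepend m {u} e₁ e₂ with map-π⁻¹ (f (suc u)) e₁
  ... | inj₁ (to-zero , refl) =
    suc m , trans (walk-step f (suc m) to-zero) (trans (walk-step f m edge) e₂)
  ... | inj₂ to-suc           = m , trans (walk-step f m to-suc) e₂

  walk⇐ : ∀ m {u u′} → walk g m u ≡ just u′ →
    ∃ λ m′ → walk f m′ (suc u) ≡ just (suc u′)
  walk⇐ zero    refl = 0 , refl
  walk⇐ (suc m) e with walk-suc⁻¹ g m e
  ... | a , e₁ , e₂ with walk⇐ m e₂
  ... | m′ , e′ with prepend m′ e₁ e′
  ... | m″ , e″ = suc m″ , e″

  cyclic⇐ : Cyclic g → Cyclic f
  cyclic⇐ (u , m , e) with walk-suc⁻¹ g m e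
  ... | a , e₁ , e₂ with walk⇐ m e₂
  ... | m′ , e′ with prepend m′ e₁ e′
  ... | m″ , e″ = suc u , m″ , e″

hasCycle-complete : {f : FunGraph k} → Cyclic f → hasCycle f ≡ true
hasCycleVia-complete : {f : FunGraph (suc k)} (b : Maybe (Fin (suc k))) → f zero ≡ b → Cyclic f →
  hasCycleVia b (f ∘ suc) ≡ true
hasCycle-complete {k = zero}      (() , _)
hasCycle-complete {k = suc k} {f} c = hasCycleVia-complete {f = f} (f zero) refl c
hasCycleVia-complete {f = f} nothing        e c = hasCycle-complete (Deletion.cyclic⇒ f e c)
hasCycleVia-complete         (just zero)    e c = refl
hasCycleVia-complete {f = f} (just (suc w)) e c = hasCycle-complete (Contraction.cyclic⇒ f w e c)

hasCycle-sound : {f : FunGraph k} → hasCycle f ≡ true → Cyclic f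
hasCycleVia-sound : {f : FunGraph (suc k)} (b : Maybe (Fin (suc k))) → f zero ≡ b →
  hasCycleVia b (f ∘ suc) ≡ true → Cyclic f
hasCycle-sound {k = zero}      ()
hasCycle-sound {k = suc k} {f} t = hasCycleVia-sound {f = f} (f zero) refl t
hasCycleVia-sound {f = f} nothing        e t = Deletion.cyclic⇐ f e (hasCycle-sound t)
hasCycleVia-sound         (just zero)    e t = zero , 0 , cong (_>>= just) e
hasCycleVia-sound {f = f} (just (suc w)) e t = Contraction.cyclic⇐ f w e (hasCycle-sound t)

walk-along : (f : FunGraph k) {m : ℕ} (c : Fin (suc m) → Fin k) →
  (∀ i → f (c (inject₁ i)) ≡ just (c (suc i))) → ∀ {y} → f (c (fromℕ m)) ≡ just y →
  walk f (suc m) (c zero) ≡ just y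
walk-along f {zero}  c edges last = cong (_>>= just) last
walk-along f {suc m} c edges last =
  trans (walk-step f (suc m) (edges zero)) (walk-along f (c ∘ suc) (edges ∘ suc) last)

leastWitness : {P : ℕ → Set} → Decidable P → ∀ {m} → P m →
  ∃ λ k → P k × (∀ {j} → j < k → ¬ P j)
leastWitness {P} P? {m} Pm
  with i , ¬¬Pi , below ← ¬∀⟶∃¬-smallest (suc m) (¬_ ∘ P ∘ toℕ) (¬? ∘ P? ∘ toℕ)
                            (λ ∀¬P → ∀¬P (fromℕ m) (subst P (sym (toℕ-fromℕ m)) Pm))
  = toℕ i , decidable-stable (P? (toℕ i)) ¬¬Pi ,
    λ j<i → subst (¬_ ∘ P) (trans (toℕ-inject (fromℕ< j<i)) (toℕ-fromℕ< j<i)) (below (fromℕ< j<i))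

module _ (T : A → A) where

  iterate-+ : ∀ a b x → iterate T x (a ℕ.+ b) ≡ iterate T (iterate T x a) b
  iterate-+ zero    b x = refl
  iterate-+ (suc a) b x = iterate-+ a b (T x)

  iterate-sucʳ : ∀ j x → iterate T x (suc j) ≡ T (iterate T x j)
  iterate-sucʳ zero    x = refl
  iterate-sucʳ (suc j) x = iterate-sucʳ j (T x)

  -- T^i v = T^j v and T^(k+1) v = v make v return already after i + (k - j) + 1 steps.
  iterates-distinct : ∀ {v k} → iterate T v (suc k) ≡ v →
    (∀ {j} → j < k → iterate T v (suc j) ≢ v) →
    ∀ {i j} → i < j → j ℕ.≤ k → iterate T v i ≢ iterate T v j
  iterates-distinct {v} {k} period minimal {i} {j} i<j j≤k Tⁱv≡Tʲv = minimal i+d<k (begin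
    iterate T v (suc (i ℕ.+ d))         ≡⟨ cong (iterate T v) (+-suc i d) ⟨
    iterate T v (i ℕ.+ suc d)           ≡⟨ iterate-+ i (suc d) v ⟩
    iterate T (iterate T v i) (suc d)   ≡⟨ cong (λ x → iterate T x (suc d)) Tⁱv≡Tʲv ⟩
    iterate T (iterate T v j) (suc d)   ≡⟨ iterate-+ j (suc d) v ⟨
    iterate T v (j ℕ.+ suc d)           ≡⟨ cong (iterate T v) (trans (+-suc j d) (cong suc j+d≡k)) ⟩
    iterate T v (suc k)                 ≡⟨ period ⟩
    v                                   ∎)
    where
    d = k ∸ j
    j+d≡k : j ℕ.+ d ≡ k
    j+d≡k = m+[n∸m]≡n j≤k
    i+d<k : i ℕ.+ d < k
    i+d<k = subst (i ℕ.+ d <_) j+d≡k (+-monoˡ-< d i<j)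

edgeOf : Fin n × Bool → Maybe (Fin n)
edgeOf x = if proj₂ x then just (proj₁ x) else nothing

graphOf : Outcome n → FunGraph n
graphOf o v = edgeOf (target o v , good o v)

edge⇒graphOf : (o : Outcome n) {v w : Fin n} → Edge o v w → graphOf o v ≡ just w
edge⇒graphOf o {v} (is-good , refl) = cong (λ b → if b then just (target o v) else nothing) is-good

graphOf⇒edge : (o : Outcome n) {v w : Fin n} → graphOf o v ≡ just w → Edge o v w
graphOf⇒edge o {v} e with good o v
... | true = refl , just-injective e

hasDirectedCycle⇒cyclic : (o : Outcome n) → HasDirectedCycle o → Cyclic (graphOf o)
hasDirectedCycle⇒cyclic o (m , c , _ , edges , closing) =
  c zero , m , walk-along (graphOf o) c (edge⇒graphOf o ∘ edges) (edge⇒graphOf o closing)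

walk-graphOf : (o : Outcome n) (j : ℕ) {x y : Fin n} → walk (graphOf o) j x ≡ just y →
  y ≡ iterate (target o) x j × (∀ {i} → i < j → good o (iterate (target o) x i) ≡ true)
walk-graphOf o zero    refl = refl , λ ()
walk-graphOf o (suc j) e with walk-suc⁻¹ (graphOf o) j e
... | a , e₁ , e₂ with graphOf⇒edge o e₁ | walk-graphOf o j e₂
... | is-good , refl | y≡ , goods = y≡ , λ { {zero} _ → is-good ; {suc i} (s≤s i<j) → goods i<j }

cyclic⇒hasDirectedCycle : (o : Outcome n) → Cyclic (graphOf o) → HasDirectedCycle o
cyclic⇒hasDirectedCycle {n = n} o (v , m , e)
  with v≡Tᵐ⁺¹v , goods ← walk-graphOf o (suc m) e
  with k , period , minimal ← leastWitness (λ j → iterate (target o) v (suc j) ≟ v) {m}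
                                           (sym v≡Tᵐ⁺¹v)
  = k , c , c-injective , edges , closing
  where
  T = target o
  c : Fin (suc k) → Fin n
  c i = iterate T v (toℕ i)

  k≤m : k ℕ.≤ m
  k≤m = ≮⇒≥ {m} {k} (λ m<k → minimal {m} m<k (sym v≡Tᵐ⁺¹v))

  c-injective : Injective _≡_ _≡_ c
  c-injective {i} {j} cᵢ≡cⱼ with <-cmp (toℕ i) (toℕ j)
  ... | tri< i<j _ _ = ⊥-elim (iterates-distinct T period minimal i<j (toℕ≤pred[n] j) cᵢ≡cⱼ)
  ... | tri≈ _ i≡j _ = toℕ-injective i≡j
  ... | tri> _ _ j<i = ⊥-elim (iterates-distinct T period minimal j<i (toℕ≤pred[n] i) (sym cᵢ≡cⱼ))

  step : ∀ {i} → i ℕ.≤ k → Edge o (iterate T v i) (iterate T v (suc i))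
  step {i} i≤k = goods (s≤s (≤-trans i≤k k≤m)) , sym (iterate-sucʳ T i v)

  edges : (i : Fin k) → Edge o (c (inject₁ i)) (c (suc i))
  edges i =
    subst (λ j → Edge o (iterate T v j) (c (suc i))) (sym (toℕ-inject₁ i)) (step (<⇒≤ (toℕ<n i)))

  closing : Edge o (c (fromℕ k)) (c zero)
  closing =
    subst (λ j → Edge o (iterate T v j) v) (sym (toℕ-fromℕ k)) (subst (Edge o _) period (step ≤-refl))

𝟙 : Bool → ℚ
𝟙 b = if b then 1ℚ else 0ℚ

𝟙∘hasCycle-cong : (𝟙 ∘ hasCycle {k}) Preserves _≗_ ⟶ _≡_
𝟙∘hasCycle-cong = cong 𝟙 ∘ hasCycle-cong

indicator≡𝟙∘hasCycle : (o : Outcome n) {x : ℚ} →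
  (HasDirectedCycle o → x ≡ 1ℚ) × (¬ HasDirectedCycle o → x ≡ 0ℚ) →
  x ≡ 𝟙 (hasCycle (graphOf o))
indicator≡𝟙∘hasCycle o (if-cycle , if-acyclic) with hasCycle (graphOf o) in eq
... | true  = if-cycle (cyclic⇒hasDirectedCycle o (hasCycle-sound eq))
... | false = if-acyclic λ cycle →
  contradiction (trans (sym eq) (hasCycle-complete (hasDirectedCycle⇒cyclic o cycle))) λ ()

-- The cycle probability

edgeLaw : ℚ → (Fin k → ℚ) → Maybe (Fin k) → ℚ
edgeLaw r q nothing  = 1ℚ - sum (λ w → r * q w)
edgeLaw r q (just w) = r * q w

edgeLaw-total : (r : ℚ) (q : Fin k → ℚ) → sumL (outEdges k) (edgeLaw r q) ≡ 1ℚ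
edgeLaw-total r q = trans (sumL-outEdges (edgeLaw r q))
  (solve 1 (λ s → (con 1ℚ :- s) :+ s := con 1ℚ) refl (sum (λ w → r * q w)))

edgeLaw-dropZero : (r : ℚ) (q : Fin (suc k) → ℚ) →
  IsPushforward (outEdges (suc k)) (edgeLaw r q) dropZero (outEdges k) (edgeLaw r (q ∘ suc))
edgeLaw-dropZero {k = k} r q G = begin
  sumL (outEdges (suc k)) (λ b → edgeLaw r q b * G (dropZero b))
    ≡⟨ sumL-outEdges (λ b → edgeLaw r q b * G (dropZero b)) ⟩
  (1ℚ - (r * q zero + S)) * G nothing + (r * q zero * G nothing + T)
    ≡⟨ solve 4 (λ a s g t → (con 1ℚ :- (a :+ s)) :* g :+ (a :* g :+ t) := (con 1ℚ :- s) :* g :+ t)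
         refl (r * q zero) S (G nothing) T ⟩
  (1ℚ - S) * G nothing + T
    ≡⟨ sumL-outEdges (λ b → edgeLaw r (q ∘ suc) b * G b) ⟨
  sumL (outEdges k) (λ b → edgeLaw r (q ∘ suc) b * G b) ∎
  where
  S = sum (λ u → r * q (suc u))
  T = sum (λ u → r * q (suc u) * G (just u))

edgeLaw-mergeZeroInto : (r : ℚ) (q : Fin (suc k) → ℚ) (w : Fin k) →
  IsPushforward (outEdges (suc k)) (edgeLaw r q) (Maybe.map (mergeZeroInto w))
                (outEdges k) (edgeLaw r (updateAt (q ∘ suc) w (_+ q zero)))
edgeLaw-mergeZeroInto {k = k} r q w G = begin
  sumL (outEdges (suc k)) (λ b → edgeLaw r q b * G (Maybe.map (mergeZeroInto w) b))
    ≡⟨ sumL-outEdges (λ b → edgeLaw r q b * G (Maybe.map (mergeZeroInto w) b)) ⟩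
  (1ℚ - (r * q zero + S)) * G nothing + (r * q zero * G (just w) + T)
    ≡⟨ solve 5 (λ a s g gw t → (con 1ℚ :- (a :+ s)) :* g :+ (a :* gw :+ t)
                             := (con 1ℚ :- (s :+ a)) :* g :+ (t :+ a :* gw))
         refl (r * q zero) S (G nothing) (G (just w)) T ⟩
  (1ℚ - (S + r * q zero)) * G nothing + (T + r * q zero * G (just w))
    ≡⟨ cong₂ (λ s t → (1ℚ - s) * G nothing + t)
         (sum-updateAt-+ (λ _ x → r * x) (λ _ → *-distribˡ-+ r) (q ∘ suc) w (q zero))
         (sum-updateAt-+ (λ u x → r * x * G (just u)) distrib (q ∘ suc) w (q zero)) ⟨
  (1ℚ - sum (λ u → r * q′ u)) * G nothing + sum (λ u → r * q′ u * G (just u))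
    ≡⟨ sumL-outEdges (λ b → edgeLaw r q′ b * G b) ⟨
  sumL (outEdges k) (λ b → edgeLaw r q′ b * G b) ∎
  where
  q′ = updateAt (q ∘ suc) w (_+ q zero)
  S = sum (λ u → r * q (suc u))
  T = sum (λ u → r * q (suc u) * G (just u))
  distrib : ∀ u a b → r * (a + b) * G (just u) ≡ r * a * G (just u) + r * b * G (just u)
  distrib u a b =
    solve 4 (λ r a b g → r :* (a :+ b) :* g := r :* a :* g :+ r :* b :* g) refl r a b (G (just u))

cycleProbability : (p q : Fin k → ℚ) →
  𝔼 k (outEdges k) (λ v → edgeLaw (p v) q) (𝟙 ∘ hasCycle) ≡ sum (λ v → p v * q v)
cycleProbability {k = zero}  p q = refl
cycleProbability {k = suc k} p q = begin
  𝔼 (suc k) (outEdges (suc k)) μ (𝟙 ∘ hasCycle)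
    ≡⟨ 𝔼-suc (outEdges (suc k)) μ (𝟙 ∘ hasCycle) ⟩
  sumL (outEdges (suc k)) (λ b → μ zero b * given b)
    ≡⟨ sumL-outEdges (λ b → μ zero b * given b) ⟩
  μ zero nothing * given nothing
    + (a * given (just zero) + sum (λ w → p zero * q (suc w) * given (just (suc w))))
    ≡⟨ cong₂ _+_ (cong (μ zero nothing *_) given-no-edge)
                 (cong₂ _+_ (cong (a *_) given-loop)
                            (sum-cong-≗ (λ w → cong (p zero * q (suc w) *_) (given-edge w)))) ⟩
  (1ℚ - (a + Q)) * S + (a * 1ℚ + sum (λ w → p zero * q (suc w) * (S + p (suc w) * q zero)))
    ≡⟨ cong (λ t → (1ℚ - (a + Q)) * S + (a * 1ℚ + t)) through-edge ⟩
  (1ℚ - (a + Q)) * S + (a * 1ℚ + (Q * S + a * S))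
    ≡⟨ solve 3 (λ a Q S → (con 1ℚ :- (a :+ Q)) :* S :+ (a :* con 1ℚ :+ (Q :* S :+ a :* S)) := a :+ S)
         refl a Q S ⟩
  a + S ∎
  where
  μ : Fin (suc k) → Maybe (Fin (suc k)) → ℚ
  μ v = edgeLaw (p v) q
  a = p zero * q zero
  Q = sum (λ w → p zero * q (suc w))
  S = sum (λ v → p (suc v) * q (suc v))

  given : Maybe (Fin (suc k)) → ℚ
  given b = 𝔼 k (outEdges (suc k)) (μ ∘ suc) (λ f → 𝟙 (hasCycleVia b f))

  given-no-edge : given nothing ≡ S
  given-no-edge = trans
    (𝔼-pushforward (outEdges (suc k)) (outEdges k) dropZero
       (μ ∘ suc) (λ v → edgeLaw (p (suc v)) (q ∘ suc)) (λ v → edgeLaw-dropZero (p (suc v)) q)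
       (𝟙 ∘ hasCycle) 𝟙∘hasCycle-cong)
    (cycleProbability (p ∘ suc) (q ∘ suc))

  given-loop : given (just zero) ≡ 1ℚ
  given-loop = 𝔼-one (outEdges (suc k)) (μ ∘ suc) (λ v → edgeLaw-total (p (suc v)) q)

  given-edge : ∀ w → given (just (suc w)) ≡ S + p (suc w) * q zero
  given-edge w = begin
    given (just (suc w))
      ≡⟨ 𝔼-pushforward (outEdges (suc k)) (outEdges k) (Maybe.map (mergeZeroInto w))
           (μ ∘ suc) (λ v → edgeLaw (p (suc v)) q′) (λ v → edgeLaw-mergeZeroInto (p (suc v)) q w)
           (𝟙 ∘ hasCycle) 𝟙∘hasCycle-cong ⟩
    𝔼 k (outEdges k) (λ v → edgeLaw (p (suc v)) q′) (𝟙 ∘ hasCycle)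
      ≡⟨ cycleProbability (p ∘ suc) q′ ⟩
    sum (λ v → p (suc v) * q′ v)
      ≡⟨ sum-updateAt-+ (λ v → p (suc v) *_) (*-distribˡ-+ ∘ p ∘ suc) (q ∘ suc) w (q zero) ⟩
    S + p (suc w) * q zero ∎
    where q′ = updateAt (q ∘ suc) w (_+ q zero)

  through-edge : sum (λ w → p zero * q (suc w) * (S + p (suc w) * q zero)) ≡ Q * S + a * S
  through-edge = begin
    sum (λ w → p zero * q (suc w) * (S + p (suc w) * q zero))
      ≡⟨ sum-cong-≗ (λ w →
           solve 5 (λ p₀ q₀ qw pw S → p₀ :* qw :* (S :+ pw :* q₀) := p₀ :* qw :* S :+ p₀ :* q₀ :* (pw :* qw))
             refl (p zero) (q zero) (q (suc w)) (p (suc w)) S) ⟩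
    sum (λ w → p zero * q (suc w) * S + a * (p (suc w) * q (suc w)))
      ≡⟨ ∑-distrib-+ (λ w → p zero * q (suc w) * S) (λ w → a * (p (suc w) * q (suc w))) ⟩
    sum (λ w → p zero * q (suc w) * S) + sum (λ w → a * (p (suc w) * q (suc w)))
      ≡⟨ cong₂ _+_ (*-distribʳ-sum S (λ w → p zero * q (suc w)))
                   (*-distribˡ-sum a (λ w → p (suc w) * q (suc w))) ⟨
    Q * S + a * S ∎

bools : List Bool
bools = true ∷ false ∷ []

choices : (n : ℕ) → List (Fin n × Bool)
choices n = cartesianProduct (allFin n) bools

choiceLaw : (n : ℕ) .{{_ : NonZero n}} → ℚ → Fin n × Bool → ℚ
choiceLaw n r x = (+ 1 / n) * (if proj₂ x then r else 1ℚ - r)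

choiceLaw-edgeOf : (n : ℕ) .{{_ : NonZero n}} (r : ℚ) →
  IsPushforward (choices n) (choiceLaw n r) edgeOf (outEdges n) (edgeLaw r (λ _ → + 1 / n))
choiceLaw-edgeOf n r G = begin
  sumL (choices n) (λ x → choiceLaw n r x * G (edgeOf x))
    ≡⟨ sumL-cartesianProduct (allFin n) bools (λ x → choiceLaw n r x * G (edgeOf x)) ⟩
  sumFin n (λ w → c * r * G (just w) + (c * (1ℚ - r) * G nothing + 0ℚ))
    ≡⟨ sumFin≡sum (λ w → c * r * G (just w) + (c * (1ℚ - r) * G nothing + 0ℚ)) ⟩
  sum (λ w → c * r * G (just w) + (c * (1ℚ - r) * G nothing + 0ℚ))
    ≡⟨ sum-cong-≗ (λ w → solve 4 (λ c r g g₀ → c :* r :* g :+ (c :* (con 1ℚ :- r) :* g₀ :+ con 0ℚ)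
                                             := r :* c :* g :+ c :* ((con 1ℚ :- r) :* g₀))
                                   refl c r (G (just w)) (G nothing)) ⟩
  sum (λ w → r * c * G (just w) + c * K)
    ≡⟨ ∑-distrib-+ (λ w → r * c * G (just w)) (λ (_ : Fin n) → c * K) ⟩
  T + sum (λ (_ : Fin n) → c * K)
    ≡⟨ cong (_+_ T) ∑cK≡K ⟩
  T + K
    ≡⟨ +-comm T K ⟩
  (1ℚ - r) * G nothing + T
    ≡⟨ cong (λ s → (1ℚ - s) * G nothing + T) r≡∑r/n ⟩
  (1ℚ - sum (λ (_ : Fin n) → r * c)) * G nothing + T
    ≡⟨ sumL-outEdges (λ y → edgeLaw r (λ _ → c) y * G y) ⟨
  sumL (outEdges n) (λ y → edgeLaw r (λ _ → c) y * G y) ∎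
  where
  c = + 1 / n
  K = (1ℚ - r) * G nothing
  T = sum (λ w → r * c * G (just w))
  ∑cK≡K : sum (λ (_ : Fin n) → c * K) ≡ K
  ∑cK≡K = trans (sym (*-distribʳ-sum K (λ (_ : Fin n) → c)))
                (trans (cong (_* K) (sum-uniform n)) (*-identityˡ K))
  r≡∑r/n : r ≡ sum (λ (_ : Fin n) → r * c)
  r≡∑r/n = trans (sym (*-identityʳ r))
                 (trans (cong (r *_) (sym (sum-uniform n))) (*-distribˡ-sum r (λ (_ : Fin n) → c)))

weightedSum≡𝔼 : (n : ℕ) .{{_ : NonZero n}} (p : Fin n → ℚ) (F : FunGraph n → ℚ) →
  F Preserves _≗_ ⟶ _≡_ →
  sumL (allOutcomes n) (λ o → weight n p o * F (graphOf o))
    ≡ 𝔼 n (choices n) (λ v → choiceLaw n (p v)) (λ h → F (edgeOf ∘ h))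
weightedSum≡𝔼 n p F F-cong = begin
  sumL (allOutcomes n) (λ o → weight n p o * F (graphOf o))
    ≡⟨ sumL-cong (allOutcomes n) (λ o →
         cong (_* F (graphOf o)) (prodFin≡∏ (λ v → choiceLaw n (p v) (target o v , good o v)))) ⟩
  sumL (allOutcomes n) (λ o → K (λ v → target o v , good o v))
    ≡⟨ trans (sumL-concatMap (λ t → map (outcome t) (allFuns n bools)) (allFuns n (allFin n)) K∘choice)
             (sumL-cong (allFuns n (allFin n)) (λ t → sumL-map (outcome t) (allFuns n bools) K∘choice)) ⟩
  sumL (allFuns n (allFin n)) (λ t → sumL (allFuns n bools) (λ g → K (λ v → t v , g v)))
    ≡⟨ sumL-allFuns-cartesianProduct (allFin n) bools K K-cong ⟩
  sumL (allFuns n (choices n)) K ∎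
  where
  K : (Fin n → Fin n × Bool) → ℚ
  K h = ∏ (λ v → choiceLaw n (p v) (h v)) * F (edgeOf ∘ h)
  K∘choice : Outcome n → ℚ
  K∘choice o = K (λ v → target o v , good o v)
  K-cong : K Preserves _≗_ ⟶ _≡_
  K-cong h≗h′ =
    cong₂ _*_ (∏-cong-≗ (λ v → cong (choiceLaw n (p v)) (h≗h′ v))) (F-cong (cong edgeOf ∘ h≗h′))

corollary1 : (n : ℕ) → .{{_ : NonZero n}} → (p : Fin n → ℚ) →
    ((v : Fin n) → (0ℚ ≤ p v) × (p v ≤ 1ℚ)) →
    (ind : Outcome n → ℚ) →
    ((o : Outcome n) → (HasDirectedCycle o → ind o ≡ 1ℚ) × (¬ HasDirectedCycle o → ind o ≡ 0ℚ)) →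
    sumL (allOutcomes n) (λ o → weight n p o * ind o) ≡ (+ 1 / n) * sumFin n p
corollary1 n p _ ind ind-spec = begin
  sumL (allOutcomes n) (λ o → weight n p o * ind o)
    ≡⟨ sumL-cong (allOutcomes n) (λ o → cong (weight n p o *_) (indicator≡𝟙∘hasCycle o (ind-spec o))) ⟩
  sumL (allOutcomes n) (λ o → weight n p o * 𝟙 (hasCycle (graphOf o)))
    ≡⟨ weightedSum≡𝔼 n p (𝟙 ∘ hasCycle) 𝟙∘hasCycle-cong ⟩
  𝔼 n (choices n) (λ v → choiceLaw n (p v)) (λ h → 𝟙 (hasCycle (edgeOf ∘ h)))
    ≡⟨ 𝔼-pushforward (choices n) (outEdges n) edgeOf
         (λ v → choiceLaw n (p v)) (λ v → edgeLaw (p v) (λ _ → c)) (λ v → choiceLaw-edgeOf n (p v))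
         (𝟙 ∘ hasCycle) 𝟙∘hasCycle-cong ⟩
  𝔼 n (outEdges n) (λ v → edgeLaw (p v) (λ _ → c)) (𝟙 ∘ hasCycle)
    ≡⟨ cycleProbability p (λ _ → c) ⟩
  sum (λ v → p v * c)
    ≡⟨ sum-cong-≗ (λ v → *-comm (p v) c) ⟩
  sum (λ v → c * p v)
    ≡⟨ trans (cong (c *_) (sumFin≡sum p)) (*-distribˡ-sum c p) ⟨
  c * sumFin n p ∎
  where c = + 1 / n
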